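{- Let $f\ge 1$ be an integer, let $G=(V,E)$ be a connected graph with unique node identifiers, and let $S$ be the greedy $(2f+2,2f+1)$-ruling set of $G$. Then there is no node $v\in S$ for which there exists an alternative node $u\notin S$ (for $v$) with $ID(u)<ID(v)$.
   Context: $dist(u,v)$ is the hop distance in $G$ and $B_t(v)=\{u\in V: dist(u,v)\le t\}$. An $(\alpha,\beta)$-ruling set is a set $S\subseteq V$ such that every two distinct nodes of $S$ are at distance at least $\alpha$, and every node is within distance at most $\beta$ of $S$. The greedy $(2f+2,2f+1)$-ruling set is constructed by iterating over the nodes in increasing order of IDs: when a node $v$ that has not been excluded is reached, it is added to $S$, and all nodes within distance $2f+1$ of $v$ are excluded. For a node $v$, a node $u\ne v$ is an alternative node (for $v$) if $dist(u,v)\le f$ and there are at most $f-2$ nodes $q\in B_{f+1}(v)\cup B_{f+1}(u)$ with $dist(q,v)\ne dist(q,u)$. -}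

module Defs where

open import Data.Nat using (ℕ; zero; suc; _+_; _*_; _≤_; _<_)
open import Data.Fin using (Fin)
open import Data.List using (List; length)
open import Data.List.Membership.Propositional using (_∈_)
open import Data.Product using (Σ; ∃; _×_; _,_)
open import Data.Sum using (_⊎_)
open import Relation.Nullary using (¬_)
open import Relation.Binary.PropositionalEquality using (_≡_; _≢_)

record Graph : Set₁ where
  field
    n     : ℕ
    Adj   : Fin n → Fin n → Set
    sym   : ∀ {u v} → Adj u v → Adj v u
    irrefl : ∀ {u} → ¬ Adj u u

open Graph public

data Walk (G : Graph) : Fin (n G) → Fin (n G) → ℕ → Set where
  here : ∀ {u} → Walk G u u zero
  step : ∀ {u w v k} → Adj G u w → Walk G w v k → Walk G u v (suc k)

Connected : Graph → Set
Connected G = ∀ u v → ∃ λ k → Walk G u v k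

Dist : (G : Graph) → Fin (n G) → Fin (n G) → ℕ → Set
Dist G u v d = Walk G u v d × (∀ k → Walk G u v k → d ≤ k)

Within : (G : Graph) → ℕ → Fin (n G) → Fin (n G) → Set
Within G t u v = ∃ λ k → k ≤ t × Walk G u v k

DiffDist : (G : Graph) → Fin (n G) → Fin (n G) → Fin (n G) → Set
DiffDist G q v u = ∃ λ d₁ → ∃ λ d₂ → Dist G q v d₁ × Dist G q u d₂ × d₁ ≢ d₂

-- u is an alternative node for v (parameter f):
-- u ≠ v, dist(u,v) ≤ f, and there are at most f-2 nodes q ∈ B_{f+1}(v) ∪ B_{f+1}(u)
-- with dist(q,v) ≠ dist(q,u).  "At most f-2 nodes" is expressed as: some list of
-- length ℓ with ℓ + 2 ≤ f contains all such q (so for f = 1 no node qualifies,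
-- matching "at most -1").
Alternative : (G : Graph) → ℕ → Fin (n G) → Fin (n G) → Set
Alternative G f v u =
  u ≢ v × Within G f u v ×
  Σ (List (Fin (n G))) λ L → length L + 2 ≤ f ×
    (∀ q → (Within G (suc f) q v ⊎ Within G (suc f) q u) → DiffDist G q v u → q ∈ L)

-- S is the greedy (2f+2,2f+1)-ruling set w.r.t. identifiers ID: processing nodes in
-- increasing ID order, v is added iff it was not excluded, i.e. iff no node w already
-- added (w ∈ S, ID w < ID v) has dist(w,v) ≤ 2f+1.
IsGreedyRulingSet : (G : Graph) → (Fin (n G) → ℕ) → ℕ → (Fin (n G) → Set) → Set
IsGreedyRulingSet G ID f S =
  ∀ v → (S v → ¬ (∃ λ w → S w × ID w < ID v × Within G (suc (2 * f)) w v))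
      × (¬ (∃ λ w → S w × ID w < ID v × Within G (suc (2 * f)) w v) → S v)

{-# OPTIONS --safe #-}
-- Let w ∈ S be the node that excluded u: ID w < ID u < ID v and dist(w,u) ≤ 2f+1, whereas
-- dist(w,v) > 2f+1 since v ∈ S. Take a shortest path from u to w, of length m. If m ≤ f, the
-- detour through u gives dist(w,v) ≤ m + f ≤ 2f+1. Otherwise its nodes q_0, …, q_{f+1} with
-- dist(q_i,u) = i all distinguish v from u, because dist(q_i,v) = i would give
-- dist(w,v) ≤ (m − i) + i = m; these are more distinguishers than an alternative node allows.
module Submission where

open import Defs
open import Data.Nat using (ℕ; _≤_; _<_)
open import Data.Fin using (Fin)
open import Data.Product using (∃; _×_)
open import Function.Definitions using (Injective)
open import Relation.Nullary using (¬_)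
open import Relation.Binary.PropositionalEquality using (_≡_)

open import Data.Nat using (zero; suc; _+_; _*_; _∸_; s≤s; s≤s⁻¹)
open import Data.Nat.Properties
  using (≤-antisym; ≤-trans; ≤-reflexive; <-trans; <⇒≱; ≮⇒≥; n≤1+n; m≤n⇒m≤1+n; m≤m+n;
         +-mono-≤; +-identityʳ; +-cancelʳ-≤; m+[n∸m]≡n; m∸n+n≡m; ≤-<-connex)
open import Data.Nat.Induction using (<-rec)
open import Data.Fin using (toℕ)
open import Data.Fin.Properties using (toℕ-injective; toℕ≤pred[n]; injective⇒≤; _≟_)
open import Data.List using (List; length)
open import Data.List.Membership.Propositional using (_∈_)
open import Data.List.Membership.DecPropositional using (_∈?_)
open import Data.List.Membership.Setoid.Properties using (index-injective)
open import Data.List.Relation.Unary.Any using (index)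
open import Data.Product using (_,_; proj₁; proj₂)
open import Data.Sum using (_⊎_; inj₁; inj₂)
open import Data.Empty using (⊥)
open import Relation.Nullary using (yes; no)
open import Relation.Nullary.Decidable using (decidable-stable; ¬¬-excluded-middle)
open import Relation.Binary.PropositionalEquality using (refl; subst; setoid)
import Relation.Binary.PropositionalEquality as ≡

-- Adjacency is an arbitrary relation, so shortest walks exist only under double negation;
-- that suffices, as every goal below is ⊥ or decidable.
Least : (ℕ → Set) → Set
Least P = ∃ λ m → P m × (∀ j → P j → m ≤ j)

¬¬-least : ∀ {P : ℕ → Set} k → P k → ¬ ¬ Least P
¬¬-least {P} = <-rec (λ k → P k → ¬ ¬ Least P) go
  where
  go : ∀ k → (∀ {j} → j < k → P j → ¬ ¬ Least P) → P k → ¬ ¬ Least P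
  go k smaller pk ¬least = ¬¬-excluded-middle {A = ∃ λ j → j < k × P j} λ where
    (yes (j , j<k , pj)) → smaller j<k pj ¬least
    (no ∄j) → ¬least (k , pk , λ j pj → ≮⇒≥ λ j<k → ∄j (j , j<k , pj))

injection⇒≤length : ∀ {A : Set} {k} {xs : List A} (a : Fin k → A) →
  Injective _≡_ _≡_ a → (∀ i → a i ∈ xs) → k ≤ length xs
injection⇒≤length {A} a a-injective a∈xs =
  injective⇒≤ {f = λ i → index (a∈xs i)}
    (λ {i} {j} eq → a-injective (index-injective (setoid A) (a∈xs i) (a∈xs j) eq))

module _ {G : Graph} where

  infixr 5 _++ᵂ_
  infixl 5 _∷ʳ_

  _++ᵂ_ : ∀ {x y z a b} → Walk G x y a → Walk G y z b → Walk G x z (a + b)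
  here     ++ᵂ W′ = W′
  step e W ++ᵂ W′ = step e (W ++ᵂ W′)

  _∷ʳ_ : ∀ {x y z k} → Walk G x y k → Adj G y z → Walk G x z (suc k)
  here       ∷ʳ e = step e here
  step e′ W ∷ʳ e = step e′ (W ∷ʳ e)

  reverse : ∀ {x y k} → Walk G x y k → Walk G y x k
  reverse here       = here
  reverse (step e W) = reverse W ∷ʳ sym G e

  splitAt : ∀ {x y k} i → i ≤ k → Walk G x y k → ∃ λ z → Walk G x z i × Walk G z y (k ∸ i)
  splitAt zero    _         W          = _ , here , W
  splitAt (suc i) (s≤s i≤k) (step e W) = let z , W₁ , W₂ = splitAt i i≤k W in z , step e W₁ , W₂

  ¬¬-Dist : ∀ {x y k} → Walk G x y k → ¬ ¬ ∃ (Dist G x y)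
  ¬¬-Dist = ¬¬-least _

  Dist-unique : ∀ {x y d d′} → Dist G x y d → Dist G x y d′ → d ≡ d′
  Dist-unique (W , shortest) (W′ , shortest′) = ≤-antisym (shortest _ W′) (shortest′ _ W)

  Dist-reverse : ∀ {x y d} → Dist G x y d → Dist G y x d
  Dist-reverse (W , shortest) = reverse W , λ k W′ → shortest k (reverse W′)

  Dist-splitAt : ∀ {x y m} i → i ≤ m → Dist G x y m → ∃ λ z → Dist G x z i × Walk G z y (m ∸ i)
  Dist-splitAt {x} {m = m} i i≤m (W , shortest) with splitAt i i≤m W
  ... | z , W₁ , W₂ = z , (W₁ , prefix-shortest) , W₂
    where
    prefix-shortest : ∀ j → Walk G x z j → i ≤ j
    prefix-shortest j V = +-cancelʳ-≤ (m ∸ i) i j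
      (subst (_≤ j + (m ∸ i)) (≡.sym (m+[n∸m]≡n i≤m)) (shortest _ (V ++ᵂ W₂)))

  Dist-injective : ∀ {x k} (a : Fin k → Fin (n G)) →
    (∀ i → Dist G x (a i) (toℕ i)) → Injective _≡_ _≡_ a
  Dist-injective a dist {i} {j} aᵢ≡aⱼ = toℕ-injective
    (Dist-unique (dist i) (subst (λ z → Dist G _ z (toℕ j)) (≡.sym aᵢ≡aⱼ) (dist j)))

CoversDistinguishers : (G : Graph) → ℕ → Fin (n G) → Fin (n G) → List (Fin (n G)) → Set
CoversDistinguishers G f v u L =
  ∀ q → (Within G (suc f) q v ⊎ Within G (suc f) q u) → DiffDist G q v u → q ∈ L

module _ {G : Graph} {f : ℕ} {v u : Fin (n G)} {L : List (Fin (n G))} where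

  distinguisher∈ : ∀ {z i k} → CoversDistinguishers G f v u L → Walk G u v k →
    Dist G z u i → i ≤ suc f → ¬ Walk G z v i → z ∈ L
  distinguisher∈ {z} {i} cover u⇝v (z⇝u , shortest) i≤1+f ¬z⇝v =
    decidable-stable (_∈?_ _≟_ z L) λ z∉L →
      ¬¬-Dist (z⇝u ++ᵂ u⇝v) λ (d , dist-zv@(z⇝v , _)) →
        z∉L (cover z (inj₂ (i , i≤1+f , z⇝u))
          (d , i , dist-zv , (z⇝u , shortest) , λ { refl → ¬z⇝v z⇝v }))

  geodesic-distinguishers : ∀ {w t k m} → CoversDistinguishers G f v u L → Walk G u v k →
    ¬ Within G t w v → m ≤ t → suc f ≤ m → Dist G u w m → suc (suc f) ≤ length L
  geodesic-distinguishers {w} {t} {m = m} cover u⇝v w↛v m≤t 1+f≤m D =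
    injection⇒≤length node (Dist-injective node node-dist) node∈L
    where
    Node : Set
    Node = Fin (suc (suc f))

    i≤m : (i : Node) → toℕ i ≤ m
    i≤m i = ≤-trans (toℕ≤pred[n] i) 1+f≤m

    split : (i : Node) → ∃ λ z → Dist G u z (toℕ i) × Walk G z w (m ∸ toℕ i)
    split i = Dist-splitAt (toℕ i) (i≤m i) D

    node : Node → Fin (n G)
    node i = proj₁ (split i)

    node-dist : ∀ i → Dist G u (node i) (toℕ i)
    node-dist i = proj₁ (proj₂ (split i))

    ¬node⇝v : ∀ i → ¬ Walk G (node i) v (toℕ i)
    ¬node⇝v i node⇝v =
      w↛v (_ , ≤-trans (≤-reflexive (m∸n+n≡m (i≤m i))) m≤t ,
           reverse (proj₂ (proj₂ (split i))) ++ᵂ node⇝v)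

    node∈L : ∀ i → node i ∈ L
    node∈L i = distinguisher∈ cover u⇝v (Dist-reverse (node-dist i)) (toℕ≤pred[n] i) (¬node⇝v i)

far⇒alternative-far : ∀ {G f v u w} → Alternative G f v u →
  ¬ Within G (suc (2 * f)) w v → ¬ Within G (suc (2 * f)) w u
far⇒alternative-far {G} {f} {u = u} {w}
  (_ , (k , k≤f , u⇝v) , L , |L|+2≤f , cover) w↛v (_ , k₀≤t , w⇝u) =
  ¬¬-Dist (reverse w⇝u) λ (m , D) →
    by-length (≤-trans (proj₂ D _ (reverse w⇝u)) k₀≤t) D (≤-<-connex (suc f) m)
  where
  by-length : ∀ {m} → m ≤ suc (2 * f) → Dist G u w m → suc f ≤ m ⊎ m < suc f → ⊥
  by-length m≤t D (inj₁ 1+f≤m) =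
    <⇒≱ (≤-trans (n≤1+n _) (geodesic-distinguishers cover u⇝v w↛v m≤t 1+f≤m D))
        (≤-trans (m≤m+n _ 2) |L|+2≤f)
  by-length {m} _ (u⇝w , _) (inj₂ m<1+f) = w↛v (m + k , m+k≤t , reverse u⇝w ++ᵂ u⇝v)
    where
    m+k≤t : m + k ≤ suc (2 * f)
    m+k≤t = m≤n⇒m≤1+n (subst (m + k ≤_) (≡.cong (f +_) (≡.sym (+-identityʳ f)))
                                       (+-mono-≤ (s≤s⁻¹ m<1+f) k≤f))

lemma6 : (f : ℕ) → 1 ≤ f → (G : Graph) → Connected G →
    (ID : Fin (n G) → ℕ) → Injective _≡_ _≡_ ID →
    (S : Fin (n G) → Set) → IsGreedyRulingSet G ID f S →
    ¬ (∃ λ v → ∃ λ u → S v × ¬ S u × Alternative G f v u × ID u < ID v)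
lemma6 f _ G _ ID _ S greedy (v , u , v∈S , u∉S , alternative , IDu<IDv) =
  u∉S (proj₂ (greedy u) λ (w , w∈S , IDw<IDu , w⇝u) →
    far⇒alternative-far alternative (v-not-excluded-by w w∈S (<-trans IDw<IDu IDu<IDv)) w⇝u)
  where
  v-not-excluded-by : ∀ w → S w → ID w < ID v → ¬ Within G (suc (2 * f)) w v
  v-not-excluded-by w w∈S IDw<IDv w⇝v = proj₁ (greedy v) v∈S (w , w∈S , IDw<IDv , w⇝v)
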